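{- Let $R(\vec x)$ be a blockwise decomposable constraint over a finite domain $D$ and let $\Pi_2(R(\vec x)):=\{\pi_Y(R(\vec x)) : Y\subseteq\tilde x,\ |Y|\le 2\}$. Then $$R(\vec x)=\bigwedge_{R'(\vec y)\in\Pi_2(R(\vec x))}R'(\vec y).$$
   Context: A constraint $R(x_1,\dots,x_k)$ with $R\subseteq D^k$ has scope $\tilde x$ and solutions the maps $\beta:\tilde x\to D$ with $(\beta(x_1),\dots,\beta(x_k))\in R$; constraints are identified with scope plus solution set. A conjunction of constraints has the union of scopes as scope and as solutions the maps whose restrictions are solutions of each conjunct. $\pi_Y$ restricts solutions to $Y$; selection $R|_{x\in S}$ keeps solutions with $\beta(x)\in S$. $R(\vec u)$ is decomposable w.r.t. a partition $(V_1,\dots,V_\ell)$ of its scope $\tilde u$ if it equals $\pi_{V_1}R(\vec u)\times\cdots\times\pi_{V_\ell}R(\vec u)$. For distinct $x,y\in\tilde u$ the selection matrix $M^R_{x,y}$ has entries $\pi_{\tilde u\setminus\{x,y\}}(R(\vec u)|_{x=a,y=b})$; proper block matrix: pairwise disjoint nonempty $A_1,\dots,A_k$, pairwise disjoint nonempty $B_1,\dots,B_k$ with entry $[a,b]$ nonempty iff $a\in A_\ell,b\in B_\ell$ for some $\ell$. $R(\vec u)$ is blockwise decomposable in $x,y$ if $M^R_{x,y}$ is a proper block matrix and each block constraint $R(\vec u)|_{x\in A_\ell,y\in B_\ell}$ is decomposable w.r.t. some partition $(V_\ell,W_\ell)$ of $\tilde u$ with $x\in V_\ell,y\in W_\ell$;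 blockwise decomposable if so for all pairs of distinct scope variables. -}

module Defs where

open import Data.Nat using (ℕ)
open import Data.Bool using (Bool; T)
open import Data.Fin using (Fin)
open import Data.Fin.Subset using (Subset; _∈_; _∉_; _∩_; Nonempty; Empty)
open import Data.Vec using (Vec; lookup)
open import Data.Product using (Σ; ∃; _×_; _,_)
open import Relation.Binary.PropositionalEquality using (_≡_; _≢_)
open import Function.Bundles using (_⇔_)

-- A solution β : scope → D is represented as the
-- tuple (β 0, …, β (n-1)) ∈ D^n; the solution set is given by its
-- (Boolean) characteristic function.
Constraint : ℕ → ℕ → Set
Constraint n d = Vec (Fin d) n → Bool

Sol : ∀ {n d} → Constraint n d → Vec (Fin d) n → Set
Sol R β = T (R β)

Agree : ∀ {n d} → Subset n → Vec (Fin d) n → Vec (Fin d) n → Set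
Agree V β γ = ∀ i → i ∈ V → lookup β i ≡ lookup γ i

PConstraint : ℕ → ℕ → Set₁
PConstraint n d = Vec (Fin d) n → Set

-- β restricted to V is a solution of π_V(S)
InProj : ∀ {n d} → PConstraint n d → Subset n → Vec (Fin d) n → Set
InProj S V β = ∃ λ γ → S γ × Agree V β γ

IsPartition₂ : ∀ {n} → Subset n → Subset n → Set
IsPartition₂ V W = (∀ i → i ∈ V → i ∉ W) × (∀ i → (i ∈ V) Data.Sum.⊎ (i ∈ W))
  where import Data.Sum

Decomposable₂ : ∀ {n d} → PConstraint n d → Subset n → Subset n → Set
Decomposable₂ S V W = ∀ β → (S β ⇔ (InProj S V β × InProj S W β))

-- entry [a , b] of the selection matrix M^R_{x,y} is nonempty
EntryNonempty : ∀ {n d} → Constraint n d → Fin n → Fin n → Fin d → Fin d → Set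
EntryNonempty R x y a b = ∃ λ β → Sol R β × lookup β x ≡ a × lookup β y ≡ b

IsProperBlockMatrix : ∀ {n d} → Constraint n d → Fin n → Fin n →
                      (k : ℕ) → (Fin k → Subset d) → (Fin k → Subset d) → Set
IsProperBlockMatrix {d = d} R x y k A B =
  (∀ l → Nonempty (A l)) × (∀ l → Nonempty (B l)) ×
  (∀ l l′ → l ≢ l′ → Empty (A l ∩ A l′)) ×
  (∀ l l′ → l ≢ l′ → Empty (B l ∩ B l′)) ×
  (∀ (a b : Fin d) → EntryNonempty R x y a b ⇔ (∃ λ l → a ∈ A l × b ∈ B l))

Block : ∀ {n d} → Constraint n d → Fin n → Fin n → Subset d → Subset d → PConstraint n d
Block R x y A B β = Sol R β × lookup β x ∈ A × lookup β y ∈ B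

BlockwiseDecomposableIn : ∀ {n d} → Constraint n d → Fin n → Fin n → Set
BlockwiseDecomposableIn {n} {d} R x y =
  Σ ℕ λ k → Σ (Fin k → Subset d) λ A → Σ (Fin k → Subset d) λ B →
    IsProperBlockMatrix R x y k A B ×
    (∀ l → Σ (Subset n) λ V → Σ (Subset n) λ W →
       IsPartition₂ V W × x ∈ V × y ∈ W × Decomposable₂ (Block R x y (A l) (B l)) V W)

BlockwiseDecomposable : ∀ {n d} → Constraint n d → Set
BlockwiseDecomposable R = ∀ x y → x ≢ y → BlockwiseDecomposableIn R x y

{-# OPTIONS --safe #-}
-- Fix β whose restriction to every set of at most two variables extends to a
-- solution; we show that β is a solution by building, for ever larger sets L
-- of variables, a solution agreeing with β on L.  Given solutions u and v that
-- agree with β on x ∷ L and on y ∷ L, the entry (u x , v y) = (β x , β y) of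
-- M^R_{x,y} is nonempty, so it lies in some block ℓ; the proper block
-- structure puts u and v into the same block constraint, and its
-- decomposability along (V , W) lets us splice u on V with v on W into a
-- solution agreeing with β on x ∷ y ∷ L.
module Submission where

open import Defs
open import Data.Nat using (_≤_; _+_; z≤n; s≤s)
open import Data.Nat.Properties using (≤-trans; ≤-reflexive; +-suc; +-monoʳ-≤; n≤1+n)
open import Data.Bool using (true; false; if_then_else_)
open import Data.Fin using (Fin; _≟_)
open import Data.Fin.Subset using (Subset; ∣_∣; _∪_; _∩_; ⁅_⁆; ⊥; _∈_; _∉_; Empty)
open import Data.Fin.Subset.Properties using (x∈⁅x⁆; ∣⁅x⁆∣≡1; ∣⊥∣≡0; x∈p∪q⁺; x∈p∩q⁺; _∈?_)
open import Data.Vec using (Vec; []; _∷_; lookup; tabulate)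
open import Data.Vec.Properties using (lookup∘tabulate; tabulate∘lookup; tabulate-cong)
open import Data.List using (List; []; _∷_; allFin)
open import Data.List.Relation.Unary.All as All using (All; []; _∷_)
open import Data.List.Membership.Propositional.Properties using (∈-allFin)
open import Data.Product using (∃; _×_; _,_; proj₁; uncurry)
open import Data.Sum using (inj₁; inj₂)
open import Relation.Binary.PropositionalEquality
open import Relation.Nullary using (yes; no; does; contradiction)
open import Function.Bundles using (_⇔_; mk⇔; Equivalence)

∣p∪q∣≤∣p∣+∣q∣ : ∀ {n} (p q : Subset n) → ∣ p ∪ q ∣ ≤ ∣ p ∣ + ∣ q ∣
∣p∪q∣≤∣p∣+∣q∣ []          []          = z≤n
∣p∪q∣≤∣p∣+∣q∣ (true ∷ p)  (true ∷ q)  =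
  s≤s (≤-trans (∣p∪q∣≤∣p∣+∣q∣ p q) (+-monoʳ-≤ ∣ p ∣ (n≤1+n ∣ q ∣)))
∣p∪q∣≤∣p∣+∣q∣ (true ∷ p)  (false ∷ q) = s≤s (∣p∪q∣≤∣p∣+∣q∣ p q)
∣p∪q∣≤∣p∣+∣q∣ (false ∷ p) (true ∷ q)  =
  ≤-trans (s≤s (∣p∪q∣≤∣p∣+∣q∣ p q)) (≤-reflexive (sym (+-suc ∣ p ∣ ∣ q ∣)))
∣p∪q∣≤∣p∣+∣q∣ (false ∷ p) (false ∷ q) = ∣p∪q∣≤∣p∣+∣q∣ p q

∣⁅x⁆∪⁅y⁆∣≤2 : ∀ {n} (x y : Fin n) → ∣ ⁅ x ⁆ ∪ ⁅ y ⁆ ∣ ≤ 2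
∣⁅x⁆∪⁅y⁆∣≤2 x y = ≤-trans (∣p∪q∣≤∣p∣+∣q∣ ⁅ x ⁆ ⁅ y ⁆)
  (≤-reflexive (cong₂ _+_ (∣⁅x⁆∣≡1 x) (∣⁅x⁆∣≡1 y)))

lookup-ext : ∀ {A : Set} {n} {u v : Vec A n} → (∀ i → lookup u i ≡ lookup v i) → u ≡ v
lookup-ext {u = u} {v} u≗v = begin
  u                   ≡⟨ tabulate∘lookup u ⟨
  tabulate (lookup u) ≡⟨ tabulate-cong u≗v ⟩
  tabulate (lookup v) ≡⟨ tabulate∘lookup v ⟩
  v                   ∎
  where open ≡-Reasoning

splice : ∀ {A : Set} {n} → Subset n → Vec A n → Vec A n → Vec A n
splice V u v = tabulate λ i → if does (i ∈? V) then lookup u i else lookup v i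

module _ {A : Set} {n} {V : Subset n} (u v : Vec A n) {i : Fin n} where

  lookup-splice : lookup (splice V u v) i ≡ (if does (i ∈? V) then lookup u i else lookup v i)
  lookup-splice = lookup∘tabulate _ i

  lookup-splice-∈ : i ∈ V → lookup (splice V u v) i ≡ lookup u i
  lookup-splice-∈ i∈V rewrite lookup-splice with i ∈? V
  ... | yes _    = refl
  ... | no i∉V = contradiction i∈V i∉V

  lookup-splice-∉ : i ∉ V → lookup (splice V u v) i ≡ lookup v i
  lookup-splice-∉ i∉V rewrite lookup-splice with i ∈? V
  ... | yes i∈V = contradiction i∈V i∉V
  ... | no _    = refl

  lookup-splice-agree : ∀ {w : Vec A n} → lookup u i ≡ lookup w i → lookup v i ≡ lookup w i →
                        lookup (splice V u v) i ≡ lookup w i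
  lookup-splice-agree ui≡wi vi≡wi with i ∈? V
  ... | yes i∈V = trans (lookup-splice-∈ i∈V) ui≡wi
  ... | no i∉V  = trans (lookup-splice-∉ i∉V) vi≡wi

Decomposable₂-splice : ∀ {n d} {S : PConstraint n d} {V W : Subset n} →
                       Decomposable₂ S V W → (∀ i → i ∈ V → i ∉ W) →
                       ∀ {u v} → S u → S v → S (splice V u v)
Decomposable₂-splice decomposable disjoint {u} {v} Su Sv =
  Equivalence.from (decomposable _)
    ( (u , Su , λ _ i∈V → lookup-splice-∈ u v i∈V)
    , (v , Sv , λ i i∈W → lookup-splice-∉ u v (λ i∈V → disjoint i i∈V i∈W)))

disjoint-family-unique : ∀ {k d} {A : Fin k → Subset d} →
                         (∀ l l′ → l ≢ l′ → Empty (A l ∩ A l′)) →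
                         ∀ {a l l′} → a ∈ A l → a ∈ A l′ → l ≡ l′
disjoint-family-unique disjoint {a} {l} {l′} a∈Al a∈Al′ with l ≟ l′
... | yes l≡l′ = l≡l′
... | no l≢l′  = contradiction (a , x∈p∩q⁺ (a∈Al , a∈Al′)) (disjoint l l′ l≢l′)

module _ {n d} {R : Constraint n d} {x y : Fin n} {k} {A B : Fin k → Subset d} where

  row-block : IsProperBlockMatrix R x y k A B →
              ∀ {a b l} → EntryNonempty R x y a b → a ∈ A l → b ∈ B l
  row-block (_ , _ , disjointA , _ , entry) {a} {b} ab a∈Al with Equivalence.to (entry a b) ab
  ... | l′ , a∈Al′ , b∈Bl′ = subst (λ m → b ∈ B m) (disjoint-family-unique disjointA a∈Al′ a∈Al) b∈Bl′

  column-block : IsProperBlockMatrix R x y k A B →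
                 ∀ {a b l} → EntryNonempty R x y a b → b ∈ B l → a ∈ A l
  column-block (_ , _ , _ , disjointB , entry) {a} {b} ab b∈Bl with Equivalence.to (entry a b) ab
  ... | l′ , a∈Al′ , b∈Bl′ = subst (λ m → a ∈ A m) (disjoint-family-unique disjointB b∈Bl′ b∈Bl) a∈Al′

blockwise-merge : ∀ {n d} {R : Constraint n d} {x y : Fin n} → BlockwiseDecomposableIn R x y →
                  ∀ {u v} → Sol R u → Sol R v → EntryNonempty R x y (lookup u x) (lookup v y) →
                  ∃ λ V → x ∈ V × y ∉ V × Sol R (splice V u v)
blockwise-merge {x = x} {y} (_ , A , B , blocks@(_ , _ , _ , _ , entry) , decomposable) {u} {v} Ru Rv uxvy
  with Equivalence.to (entry _ _) uxvy
... | l , ux∈A , vy∈B with decomposable l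
... | V , W , (disjoint , _) , x∈V , y∈W , decomposableˡ =
  V , x∈V , (λ y∈V → disjoint y y∈V y∈W) ,
  proj₁ (Decomposable₂-splice decomposableˡ disjoint (Ru , ux∈A , uy∈B) (Rv , vx∈A , vy∈B))
  where
  uy∈B : lookup u y ∈ B l
  uy∈B = row-block blocks (u , Ru , refl , refl) ux∈A
  vx∈A : lookup v x ∈ A l
  vx∈A = column-block blocks (v , Rv , refl , refl) vy∈B

module _ {n d} (R : Constraint n d) (β : Vec (Fin d) n) where

  SolutionAgreeingOn : List (Fin n) → Set
  SolutionAgreeingOn L = ∃ λ γ → Sol R γ × All (λ i → lookup γ i ≡ lookup β i) L

  SolutionAgreeingOn-allFin⇒Sol : SolutionAgreeingOn (allFin n) → Sol R β
  SolutionAgreeingOn-allFin⇒Sol (γ , Rγ , γ≗β) =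
    subst (Sol R) (lookup-ext (λ i → All.lookup γ≗β (∈-allFin i))) Rγ

  InProj-pair⇒EntryNonempty : ∀ x y → InProj (Sol R) (⁅ x ⁆ ∪ ⁅ y ⁆) β →
                              EntryNonempty R x y (lookup β x) (lookup β y)
  InProj-pair⇒EntryNonempty x y (γ , Rγ , β≗γ) =
    γ , Rγ , sym (β≗γ x (x∈p∪q⁺ (inj₁ (x∈⁅x⁆ x)))) , sym (β≗γ y (x∈p∪q⁺ (inj₂ (x∈⁅x⁆ y))))

  module _ (decomposable : BlockwiseDecomposable R)
           (pairs : ∀ x y → EntryNonempty R x y (lookup β x) (lookup β y)) where

    merge : ∀ {x y L} → x ≢ y → SolutionAgreeingOn (x ∷ L) → SolutionAgreeingOn (y ∷ L) →
            SolutionAgreeingOn (x ∷ y ∷ L)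
    merge {x} {y} x≢y (u , Ru , ux ∷ uL) (v , Rv , vy ∷ vL)
      with blockwise-merge (decomposable x y x≢y) Ru Rv
             (subst₂ (EntryNonempty R x y) (sym ux) (sym vy) (pairs x y))
    ... | V , x∈V , y∉V , Rδ =
      splice V u v , Rδ ,
      trans (lookup-splice-∈ u v x∈V) ux ∷ trans (lookup-splice-∉ u v y∉V) vy ∷
      All.zipWith (uncurry (lookup-splice-agree u v {w = β})) (uL , vL)

    SolutionAgreeingOn-∷ : ∀ x L → SolutionAgreeingOn (x ∷ L)
    -- The diagonal entry pairs x x is the one-variable projection onto x.
    SolutionAgreeingOn-∷ x [] with pairs x x
    ... | γ , Rγ , γx≡βx , _ = γ , Rγ , γx≡βx ∷ []
    SolutionAgreeingOn-∷ x (y ∷ L) with x ≟ y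
    ... | yes refl with SolutionAgreeingOn-∷ x L
    ...   | γ , Rγ , γx ∷ γL = γ , Rγ , γx ∷ γx ∷ γL
    SolutionAgreeingOn-∷ x (y ∷ L) | no x≢y =
      merge x≢y (SolutionAgreeingOn-∷ x L) (SolutionAgreeingOn-∷ y L)

    SolutionAgreeingOn-all : SolutionAgreeingOn [] → ∀ L → SolutionAgreeingOn L
    SolutionAgreeingOn-all R≢∅ []      = R≢∅
    SolutionAgreeingOn-all _   (x ∷ L) = SolutionAgreeingOn-∷ x L

lemma16 : ∀ {n d} (R : Constraint n d) → BlockwiseDecomposable R →
            ∀ (β : Vec (Fin d) n) →
              Sol R β ⇔ (∀ (Y : Subset n) → ∣ Y ∣ ≤ 2 → InProj (Sol R) Y β)
lemma16 {n} R decomposable β = mk⇔ projections solution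
  where
  projections : Sol R β → ∀ Y → ∣ Y ∣ ≤ 2 → InProj (Sol R) Y β
  projections Rβ _ _ = β , Rβ , λ _ _ → refl

  solution : (∀ Y → ∣ Y ∣ ≤ 2 → InProj (Sol R) Y β) → Sol R β
  solution proj = SolutionAgreeingOn-allFin⇒Sol R β
    (SolutionAgreeingOn-all R β decomposable pairs nonempty (allFin n))
    where
    pairs : ∀ x y → EntryNonempty R x y (lookup β x) (lookup β y)
    pairs x y = InProj-pair⇒EntryNonempty R β x y (proj (⁅ x ⁆ ∪ ⁅ y ⁆) (∣⁅x⁆∪⁅y⁆∣≤2 x y))
    nonempty : SolutionAgreeingOn R β []
    nonempty with proj ⊥ (subst (_≤ 2) (sym (∣⊥∣≡0 n)) z≤n)
    ... | γ , Rγ , _ = γ , Rγ , []
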